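{- Let $M=(\Sigma_\Box,Q,q_{in},q_{fin},\delta)$ be a Turing machine. There is a term $\mathtt{init}$ of $\Lambda_{\tt det}$ such that for every continuation $k$ (a value) and every $s \in \Sigma^*$, $$\mathtt{init}\; k\; \ulcorner s\urcorner_{\Sigma^*} \rightarrow_{det}^{\Theta(|s|)} k\; \ulcorner C_{in}(s)\urcorner,$$ where $C_{in}(s) = (\varepsilon,\Box,s,q_{in})$ is the initial configuration of $M$ for $s$.
   Context: $\Lambda_{\tt det}$: terms $t ::= v \mid t\,v$, values $v ::= \lambda x.t \mid x$; evaluation contexts $E ::= [\cdot] \mid E\,v$; reduction $E[(\lambda x.t)s] \rightarrow_{det} E[t\{x:=s\}]$; $\rightarrow_{det}^{\Theta(|s|)}$ is a reduction of $\Theta(|s|)$ steps, constants depending only on $M$. A Turing machine $M$ has a finite alphabet $\Sigma=\{a_1,\dots,a_n\}$ plus a blank symbol $\Box$ (tape alphabet $\Sigma_\Box=\Sigma\cup\{\Box\}$, $\Box$ last in the order), a finite state set $Q=\{q_1,\dots,q_m\}$, initial and final states $q_{in},q_{fin}$, and a partial transition function $\delta$ from $Q\times\Sigma_\Box$ to $Q\times\Sigma_\Box\times\{\leftarrow,\rightarrow,\downarrow\}$ defined exactly on the pairs whose state is not $q_{fin}$. A configuration is a quadruple $(s,a,r,q)$: tape left of the head $s$, symbol $a$ under the head, tape right of the head $r$, state $q$. Scott encoding for an ordered alphabet $\Delta=\{b_1,\dots,b_n\}$: $\ulcorner b_i\urcorner_\Delta := \lambda x_1.\dots\lambda x_n.x_i$,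 $\ulcorner \varepsilon\urcorner_{\Delta^*} := \lambda x_1.\dots\lambda x_n.\lambda y.y$, $\ulcorner b_i r\urcorner_{\Delta^*} := \lambda x_1.\dots\lambda x_n.\lambda y.x_i\,\ulcorner r\urcorner_{\Delta^*}$; $Q$ is encoded as an alphabet. Configurations are encoded as $\ulcorner (s,a,r,q)\urcorner := \lambda x.\, x\,\ulcorner s^r\urcorner_{\Sigma_\Box^*}\,\ulcorner a\urcorner_{\Sigma_\Box}\,\ulcorner r\urcorner_{\Sigma_\Box^*}\,\ulcorner q\urcorner_Q$, where $s^r$ is the reversal of $s$. -}

module Defs where

open import Data.Nat using (ℕ; zero; suc; _+_; _*_; _∸_; _<_; _≤_)
open import Data.Fin using (Fin; toℕ; fromℕ; inject₁)
open import Data.List using (List; []; _∷_; reverse; map; length)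
open import Data.Maybe using (Maybe; just; nothing)
open import Data.Product using (_×_; _,_; ∃; ∃-syntax)
open import Relation.Binary.PropositionalEquality using (_≡_; _≢_)
open import Relation.Nullary using (¬_)

-- Λ_det in de Bruijn notation:  t ::= v | t v ,  v ::= λ.t | x

mutual
  data Term : Set where
    val : Val → Term
    app : Term → Val → Term

  data Val : Set where
    var : ℕ → Val
    lam : Term → Val

shiftVar : ℕ → ℕ → ℕ
shiftVar zero    x       = suc x
shiftVar (suc c) zero    = zero
shiftVar (suc c) (suc x) = suc (shiftVar c x)

mutual
  shiftT : ℕ → Term → Term
  shiftT c (val v)   = val (shiftV c v)
  shiftT c (app t v) = app (shiftT c t) (shiftV c v)

  shiftV : ℕ → Val → Val
  shiftV c (var x) = var (shiftVar c x)
  shiftV c (lam t) = lam (shiftT (suc c) t)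

-- capture-avoiding substitution of the value w for variable j,
-- free variables above j are decremented (the binder disappears)
substVar : ℕ → Val → ℕ → Val
substVar zero    w zero    = w
substVar zero    w (suc x) = var x
substVar (suc j) w zero    = var zero
substVar (suc j) w (suc x) = shiftV 0 (substVar j w x)

mutual
  substT : ℕ → Val → Term → Term
  substT j w (val v)   = val (substV j w v)
  substT j w (app t v) = app (substT j w t) (substV j w v)

  substV : ℕ → Val → Val → Val
  substV j w (var x) = substVar j w x
  substV j w (lam t) = lam (substT (suc j) w t)

_[_] : Term → Val → Term
t [ s ] = substT 0 s t

-- Deterministic (weak head) reduction:  E ::= [·] | E v
--   E[(λx.t) s] →det E[t{x:=s}]
data _→det_ : Term → Term → Set where
  β   : ∀ {t s} → app (val (lam t)) s →det (t [ s ])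
  ctx : ∀ {t t′ v} → t →det t′ → app t v →det app t′ v

data _→det[_]_ : Term → ℕ → Term → Set where
  done : ∀ {t} → t →det[ 0 ] t
  step : ∀ {t u w k} → t →det u → u →det[ k ] w → t →det[ suc k ] w

mutual
  ScopedT : ℕ → Term → Set
  ScopedT b (val v)   = ScopedV b v
  ScopedT b (app t v) = ScopedT b t × ScopedV b v

  ScopedV : ℕ → Val → Set
  ScopedV b (var x) = x < b
  ScopedV b (lam t) = ScopedT (suc b) t

Closed : Term → Set
Closed = ScopedT 0

-- Scott encodings (alphabet of size k is Fin k, ordered by Fin order)

lams : ℕ → Term → Term
lams zero    t = t
lams (suc k) t = val (lam (lams k t))

-- ⌜b_i⌝ = λx₁…λx_k. x_i
encSym : ∀ {k} → Fin k → Val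
encSym {suc k} i = lam (lams k (val (var (k ∸ toℕ i))))

-- ⌜ε⌝ = λx₁…λx_k.λy.y ,  ⌜b_i r⌝ = λx₁…λx_k.λy. x_i ⌜r⌝
encStr : ∀ {k} → List (Fin k) → Val
encStr {k} []      = lam (lams k (val (var 0)))
encStr {k} (i ∷ r) = lam (lams k (app (val (var (k ∸ toℕ i))) (encStr r)))

-- Turing machines: Σ = Fin n, Σ_□ = Fin (suc n) with □ the last symbol,
-- Q = Fin m

data Move : Set where
  left right stay : Move

record TM : Set where
  field
    n    : ℕ
    m    : ℕ
    qin  : Fin m
    qfin : Fin m
    δ    : Fin m → Fin (suc n) → Maybe (Fin m × Fin (suc n) × Move)
    δ-final   : ∀ a → δ qfin a ≡ nothing
    δ-defined : ∀ q a → q ≢ qfin → ∃[ r ] δ q a ≡ just r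

module _ (M : TM) where
  open TM M

  Σ : Set
  Σ = Fin n

  Σ□ : Set
  Σ□ = Fin (suc n)

  □ : Σ□
  □ = fromℕ n

  Σ→Σ□ : Σ → Σ□
  Σ→Σ□ = inject₁

  record Config : Set where
    constructor config
    field
      leftTape  : List Σ□
      headSym   : Σ□
      rightTape : List Σ□
      state     : Fin m

  -- ⌜(s,a,r,q)⌝ = λx. x ⌜s^r⌝ ⌜a⌝ ⌜r⌝ ⌜q⌝
  encConf : Config → Val
  encConf (config s a r q) =
    lam (app (app (app (app (val (var 0)) (encStr (reverse s))) (encSym a))
                  (encStr r)) (encSym q))

  Cin : List Σ → Config
  Cin s = config [] □ (map Σ→Σ□ s) qin

-- The input ⌜s⌝ over Σ is turned into ⌜s⌝ over Σ□ by a self-applied recursive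
-- converter in continuation-passing style: applied to one branch per symbol of Σ
-- and a nil branch, the Scott encoding of a string performs the case analysis
-- itself, and the branch for a symbol a recurses on the tail with a continuation that
-- prepends ⌜a⌝ over the larger alphabet.  Each symbol costs a constant number of
-- β-steps (depending on |Σ|), and a final continuation packs the converted string
-- into the initial configuration, so the reduction takes Θ(|s|) steps.
module Submission where

open import Defs
open import Data.Nat using (ℕ; zero; suc; _+_; _*_; _∸_; _≤_; _<_; z≤n; s≤s; _<ᵇ_)
open import Data.Nat.Properties
open import Data.Nat.Tactic.RingSolver using (solve-∀)
open import Data.Bool using (true; false; if_then_else_)
open import Data.Fin using (Fin; toℕ; inject₁; fromℕ)
open import Data.Fin.Properties using (toℕ<n; toℕ-inject₁)
open import Data.List using (List; []; _∷_; length; map)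
open import Data.List.Relation.Unary.All using (All; []; _∷_)
open import Data.Product using (_×_; _,_; ∃-syntax)
open import Data.Sum using (inj₁; inj₂)
open import Relation.Binary.PropositionalEquality
  using (_≡_; refl; sym; trans; cong; cong₂; subst)

ClosedV : Val → Set
ClosedV = ScopedV 0

shiftVar-< : ∀ c x → x < c → shiftVar c x ≡ x
shiftVar-< (suc c) zero    _       = refl
shiftVar-< (suc c) (suc x) (s≤s p) = cong suc (shiftVar-< c x p)

mutual
  shiftT-scoped : ∀ {b} c t → ScopedT b t → b ≤ c → shiftT c t ≡ t
  shiftT-scoped c (val v)   sv         b≤c = cong val (shiftV-scoped c v sv b≤c)
  shiftT-scoped c (app t v) (st , sv) b≤c =
    cong₂ app (shiftT-scoped c t st b≤c) (shiftV-scoped c v sv b≤c)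

  shiftV-scoped : ∀ {b} c v → ScopedV b v → b ≤ c → shiftV c v ≡ v
  shiftV-scoped c (var x) x<b b≤c = cong var (shiftVar-< c x (≤-trans x<b b≤c))
  shiftV-scoped c (lam t) st  b≤c = cong lam (shiftT-scoped (suc c) t st (s≤s b≤c))

substVar-< : ∀ j w x → x < j → substVar j w x ≡ var x
substVar-< (suc j) w zero    _       = refl
substVar-< (suc j) w (suc x) (s≤s p) = cong (shiftV 0) (substVar-< j w x p)

mutual
  substT-scoped : ∀ {b} j w t → ScopedT b t → b ≤ j → substT j w t ≡ t
  substT-scoped j w (val v)   sv        b≤j = cong val (substV-scoped j w v sv b≤j)
  substT-scoped j w (app t v) (st , sv) b≤j =
    cong₂ app (substT-scoped j w t st b≤j) (substV-scoped j w v sv b≤j)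

  substV-scoped : ∀ {b} j w v → ScopedV b v → b ≤ j → substV j w v ≡ v
  substV-scoped j w (var x) x<b b≤j = substVar-< j w x (≤-trans x<b b≤j)
  substV-scoped j w (lam t) st  b≤j = cong lam (substT-scoped (suc j) w t st (s≤s b≤j))

substT-closed : ∀ j w t → ScopedT 0 t → substT j w t ≡ t
substT-closed j w t st = substT-scoped j w t st z≤n

substV-closed : ∀ j w v → ClosedV v → substV j w v ≡ v
substV-closed j w v sv = substV-scoped j w v sv z≤n

substVar-self : ∀ j w → ClosedV w → substVar j w j ≡ w
substVar-self zero    w _  = refl
substVar-self (suc j) w sw =
  trans (cong (shiftV 0) (substVar-self j w sw)) (shiftV-scoped 0 w sw z≤n)

substVar-shiftVar : ∀ c w x → substVar c w (shiftVar c x) ≡ var x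
substVar-shiftVar zero    w x       = refl
substVar-shiftVar (suc c) w zero    = refl
substVar-shiftVar (suc c) w (suc x) = cong (shiftV 0) (substVar-shiftVar c w x)

mutual
  substT-shiftT : ∀ c w t → substT c w (shiftT c t) ≡ t
  substT-shiftT c w (val v)   = cong val (substV-shiftV c w v)
  substT-shiftT c w (app t v) = cong₂ app (substT-shiftT c w t) (substV-shiftV c w v)

  substV-shiftV : ∀ c w v → substV c w (shiftV c v) ≡ v
  substV-shiftV c w (var x) = substVar-shiftVar c w x
  substV-shiftV c w (lam t) = cong lam (substT-shiftT (suc c) w t)

substT-lams : ∀ k j w t → substT j w (lams k t) ≡ lams k (substT (k + j) w t)
substT-lams zero    j w t = refl
substT-lams (suc k) j w t =
  cong (λ u → val (lam u)) (trans (substT-lams k (suc j) w t)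
                                  (cong (λ i → lams k (substT i w t)) (+-suc k j)))

mutual
  ScopedT-weaken : ∀ {b b′} t → ScopedT b t → b ≤ b′ → ScopedT b′ t
  ScopedT-weaken (val v)   sv        b≤b′ = ScopedV-weaken v sv b≤b′
  ScopedT-weaken (app t v) (st , sv) b≤b′ = ScopedT-weaken t st b≤b′ , ScopedV-weaken v sv b≤b′

  ScopedV-weaken : ∀ {b b′} v → ScopedV b v → b ≤ b′ → ScopedV b′ v
  ScopedV-weaken (var x) x<b b≤b′ = ≤-trans x<b b≤b′
  ScopedV-weaken (lam t) st  b≤b′ = ScopedT-weaken t st (s≤s b≤b′)

ClosedV-weaken : ∀ b v → ClosedV v → ScopedV b v
ClosedV-weaken b v sv = ScopedV-weaken v sv z≤n

ScopedT-lams : ∀ k b t → ScopedT (k + b) t → ScopedT b (lams k t)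
ScopedT-lams zero    b t st = st
ScopedT-lams (suc k) b t st = ScopedT-lams k (suc b) t (subst (λ i → ScopedT i t) (sym (+-suc k b)) st)

encSym-closed : ∀ {k} (i : Fin k) → ClosedV (encSym i)
encSym-closed {suc k} i = ScopedT-lams k 1 _ (subst (k ∸ toℕ i <_) (+-comm 1 k) (s≤s (m∸n≤m k (toℕ i))))

encStr-closed : ∀ {k} (r : List (Fin k)) → ClosedV (encStr r)
encStr-closed {k} []      = ScopedT-lams k 1 _ (subst (0 <_) (+-comm 1 k) (s≤s z≤n))
encStr-closed {k} (i ∷ r) = ScopedT-lams k 1 _
  ( subst (k ∸ toℕ i <_) (+-comm 1 k) (s≤s (m∸n≤m k (toℕ i)))
  , ClosedV-weaken (k + 1) (encStr r) (encStr-closed r))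

infixr 5 _▷_

_▷_ : ∀ {t u w a b} → t →det[ a ] u → u →det[ b ] w → t →det[ a + b ] w
done     ▷ q = q
step x p ▷ q = step x (p ▷ q)

one-step : ∀ {t u} → t →det u → t →det[ 1 ] u
one-step x = step x done

ctx* : ∀ {t u k v} → t →det[ k ] u → app t v →det[ k ] app u v
ctx* done       = done
ctx* (step x p) = step (ctx x) (ctx* p)

retarget : ∀ {t u u′ k} → t →det[ k ] u → u ≡ u′ → t →det[ k ] u′
retarget p refl = p

β≡ : ∀ {t s u} → t [ s ] ≡ u → app (val (lam t)) s →det u
β≡ refl = β

appN : Term → ℕ → (ℕ → Val) → Term
appN t zero    a = t
appN t (suc m) a = appN (app t (a 0)) m (λ i → a (suc i))

apps : Term → List Val → Term
apps t []       = t
apps t (r ∷ rs) = apps (app t r) rs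

appN-ctx : ∀ m a {t u} → t →det u → appN t m a →det appN u m a
appN-ctx zero    a x = x
appN-ctx (suc m) a x = appN-ctx m (λ i → a (suc i)) (ctx x)

appN-scoped : ∀ {b} m a t → ScopedT b t → (∀ i → ScopedV b (a i)) → ScopedT b (appN t m a)
appN-scoped zero    a t st sa = st
appN-scoped (suc m) a t st sa = appN-scoped m (λ i → a (suc i)) (app t (a 0)) (st , sa 0) (λ i → sa (suc i))

substT-appN : ∀ j w m a t → (∀ i → ClosedV (a i)) →
              substT j w (appN t m a) ≡ appN (substT j w t) m a
substT-appN j w zero    a t sa = refl
substT-appN j w (suc m) a t sa =
  trans (substT-appN j w m (λ i → a (suc i)) (app t (a 0)) (λ i → sa (suc i)))
        (cong (λ v → appN (app (substT j w t) v) m (λ i → a (suc i))) (substV-closed j w (a 0) (sa 0)))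

substT-apps : ∀ j w t rs → All ClosedV rs → substT j w (apps t rs) ≡ apps (substT j w t) rs
substT-apps j w t []       []         = refl
substT-apps j w t (r ∷ rs) (sr ∷ srs) =
  trans (substT-apps j w (app t r) rs srs)
        (cong (λ v → apps (app (substT j w t) v) rs) (substV-closed j w r sr))

apps-closed : ∀ t rs → ScopedT 0 t → All ClosedV rs → ScopedT 0 (apps t rs)
apps-closed t []       st []         = st
apps-closed t (r ∷ rs) st (sr ∷ srs) = apps-closed (app t r) rs (st , sr) srs

-- Simultaneous substitution into the body of λ^(k+1): a i replaces the i-th binder,
-- which is the de Bruijn index k ∸ i.
instantiate : ℕ → (ℕ → Val) → Term → Term
instantiate zero    a t = t [ a 0 ]
instantiate (suc k) a t = instantiate k (λ i → a (suc i)) (substT (suc k) (a 0) t)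

lams-β* : ∀ k a t → appN (val (lam (lams k t))) (suc k) a →det[ suc k ] instantiate k a t
lams-β* zero    a t = one-step β
lams-β* (suc k) a t =
  step (appN-ctx (suc k) (λ i → a (suc i)) (β≡ body))
       (lams-β* k (λ i → a (suc i)) (substT (suc k) (a 0) t))
  where
    body : lams (suc k) t [ a 0 ] ≡ lams (suc k) (substT (suc k) (a 0) t)
    body = trans (substT-lams (suc k) 0 (a 0) t)
                 (cong (λ i → lams (suc k) (substT i (a 0) t)) (+-identityʳ (suc k)))

instantiate-closed : ∀ k a t → ScopedT 0 t → instantiate k a t ≡ t
instantiate-closed zero    a t st = substT-closed 0 (a 0) t st
instantiate-closed (suc k) a t st =
  trans (cong (instantiate k (λ i → a (suc i))) (substT-closed (suc k) (a 0) t st))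
        (instantiate-closed k (λ i → a (suc i)) t st)

instantiate-head : ∀ k x a rs → x ≤ k → (∀ i → ClosedV (a i)) → All ClosedV rs →
                   instantiate k a (apps (val (var x)) rs) ≡ apps (val (a (k ∸ x))) rs
instantiate-head zero    zero a rs _   sa srs = substT-apps 0 (a 0) (val (var 0)) rs srs
instantiate-head (suc k) x    a rs x≤k sa srs
  rewrite substT-apps (suc k) (a 0) (val (var x)) rs srs with m≤n⇒m<n∨m≡n x≤k
... | inj₂ refl rewrite substVar-self (suc k) (a 0) (sa 0) | n∸n≡0 k =
  instantiate-closed k _ (apps (val (a 0)) rs) (apps-closed _ rs (sa 0) srs)
... | inj₁ (s≤s x≤k′) rewrite substVar-< (suc k) (a 0) x (s≤s x≤k′) =
  trans (instantiate-head k x (λ i → a (suc i)) rs x≤k′ (λ i → sa (suc i)) srs)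
        (cong (λ i → apps (val (a i)) rs) (sym (+-∸-assoc 1 x≤k′)))

-- Scott case analysis: a datum whose body is x_i applied to its fields selects the i-th branch.
select : ∀ k x a rs → x ≤ k → (∀ i → ClosedV (a i)) → All ClosedV rs →
         appN (val (lam (lams k (apps (val (var x)) rs)))) (suc k) a →det[ suc k ] apps (val (a (k ∸ x))) rs
select k x a rs x≤k sa srs =
  retarget (lams-β* k a _) (instantiate-head k x a rs x≤k sa srs)

n<ᵇn≡false : ∀ k → (k <ᵇ k) ≡ false
n<ᵇn≡false zero    = refl
n<ᵇn≡false (suc k) = n<ᵇn≡false k

module Conversion (M : TM) where
  open TM M

  -- ⌜b_i x⌝ over Σ□, with the tail x free as index 0.
  consTemplate : ℕ → Val
  consTemplate i = lam (lams (suc n) (app (val (var (suc n ∸ i))) (var (suc (suc n)))))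

  -- λR.λg.λK. g R g (λx. K ⌜b_i x⌝)
  onCons : ℕ → Val
  onCons i = lam (val (lam (val (lam
    (app (app (app (val (var 1)) (var 2)) (var 1)) (lam (app (val (var 1)) (consTemplate i))))))))

  empty : Val
  empty = encStr {suc n} []

  onNil : Val
  onNil = lam (val (lam (app (val (var 0)) empty)))

  branch : ℕ → Val
  branch i = if i <ᵇ n then onCons i else onNil

  -- λS.λg.λK. S branch₀ … branchₙ g K; it is always called with g = convert itself.
  convert : Val
  convert = lam (val (lam (val (lam (app (app (appN (val (var 2)) (suc n) branch) (var 1)) (var 0))))))

  consTemplate-scoped : ∀ i → ScopedV 1 (consTemplate i)
  consTemplate-scoped i = ScopedT-lams (suc n) 2 _
    (subst (λ b → suc n ∸ i < b × suc (suc n) < b) (+-comm 2 (suc n))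
           (s≤s (≤-trans (m∸n≤m (suc n) i) (n≤1+n (suc n))) , ≤-refl))

  onCons-closed : ∀ i → ClosedV (onCons i)
  onCons-closed i = ((1<3 , ≤-refl) , 1<3)
                  , s≤s (s≤s z≤n) , ScopedV-weaken (consTemplate i) (consTemplate-scoped i) (s≤s z≤n)
    where
      1<3 : 1 < 3
      1<3 = s≤s (s≤s z≤n)

  empty-closed : ClosedV empty
  empty-closed = encStr-closed {suc n} []

  onNil-closed : ClosedV onNil
  onNil-closed = s≤s z≤n , ClosedV-weaken 2 empty empty-closed

  branch-closed : ∀ i → ClosedV (branch i)
  branch-closed i with i <ᵇ n
  ... | true  = onCons-closed i
  ... | false = onNil-closed

  branch-< : ∀ i → i < n → branch i ≡ onCons i
  branch-< i i<n with i <ᵇ n | <⇒<ᵇ i<n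
  ... | true | _ = refl

  branch-n : branch n ≡ onNil
  branch-n rewrite n<ᵇn≡false n = refl

  convert-closed : ClosedV convert
  convert-closed = ( appN-scoped (suc n) branch (val (var 2)) (s≤s (s≤s (s≤s z≤n)))
                       (λ i → ClosedV-weaken 3 (branch i) (branch-closed i))
                   , s≤s (s≤s z≤n))
                 , s≤s z≤n

  convert-unfold : ∀ S g K → ClosedV S → ClosedV g →
                   app (app (app (val convert) S) g) K →det[ 3 ] app (app (appN (val S) (suc n) branch) g) K
  convert-unfold S g K sS sg = step (ctx (ctx (β≡ e₁))) (step (ctx (β≡ e₂)) (one-step (β≡ e₃)))
    where
      X = appN (val S) (suc n) branch
      sX : ScopedT 0 X
      sX = appN-scoped (suc n) branch (val S) sS branch-closed
      e₁ : val (lam (val (lam (app (app (appN (val (var 2)) (suc n) branch) (var 1)) (var 0))))) [ S ]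
           ≡ val (lam (val (lam (app (app X (var 1)) (var 0)))))
      e₁ = cong (λ u → val (lam (val (lam (app (app u (var 1)) (var 0))))))
             (trans (substT-appN 2 S (suc n) branch (val (var 2)) branch-closed)
                    (cong (λ v → appN (val v) (suc n) branch) (substVar-self 2 S sS)))
      e₂ : val (lam (app (app X (var 1)) (var 0))) [ g ] ≡ val (lam (app (app X g) (var 0)))
      e₂ = cong₂ (λ u v → val (lam (app (app u v) (var 0)))) (substT-closed 1 g X sX) (substVar-self 1 g sg)
      e₃ : app (app X g) (var 0) [ K ] ≡ app (app X g) K
      e₃ = cong₂ (λ u v → app (app u v) K) (substT-closed 0 K X sX) (substV-closed 0 K g sg)

  onNil-unfold : ∀ g K → ClosedV g → app (app (val onNil) g) K →det[ 2 ] app (val K) empty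
  onNil-unfold g K sg =
    step (ctx (β≡ (cong (λ v → val (lam (app (val (var 0)) v))) (substV-closed 1 g empty empty-closed))))
         (one-step (β≡ (cong (app (val K)) (substV-closed 0 K empty empty-closed))))

  onCons-unfold : ∀ i R g K → ClosedV R → ClosedV g →
                  app (app (app (val (onCons i)) R) g) K
                    →det[ 3 ] app (app (app (val g) R) g) (lam (app (val (shiftV 0 K)) (consTemplate i)))
  onCons-unfold i R g K sR sg = step (ctx (ctx (β≡ e₁))) (step (ctx (β≡ e₂)) (one-step (β≡ e₃)))
    where
      T = consTemplate i
      sT = consTemplate-scoped i
      e₁ : val (lam (val (lam (app (app (app (val (var 1)) (var 2)) (var 1)) (lam (app (val (var 1)) T)))))) [ R ]
           ≡ val (lam (val (lam (app (app (app (val (var 1)) R) (var 1)) (lam (app (val (var 1)) T))))))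
      e₁ = cong₂ (λ v T′ → val (lam (val (lam (app (app (app (val (var 1)) v) (var 1)) (lam (app (val (var 1)) T′)))))))
             (substVar-self 2 R sR) (substV-scoped 3 R T sT (s≤s z≤n))
      e₂ : val (lam (app (app (app (val (var 1)) R) (var 1)) (lam (app (val (var 1)) T)))) [ g ]
           ≡ val (lam (app (app (app (val g) R) g) (lam (app (val (var 1)) T))))
      e₂ = cong₂ (λ (p : Val × Val) T′ → let (g′ , R′) = p in
                    val (lam (app (app (app (val g′) R′) g′) (lam (app (val (var 1)) T′)))))
             (cong₂ _,_ (substVar-self 1 g sg) (substV-closed 1 g R sR)) (substV-scoped 2 g T sT (s≤s z≤n))
      e₃ : app (app (app (val g) R) g) (lam (app (val (var 1)) T)) [ K ]
           ≡ app (app (app (val g) R) g) (lam (app (val (shiftV 0 K)) T))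
      e₃ = cong₂ (λ (p : Val × Val) T′ → let (g′ , R′) = p in
                    app (app (app (val g′) R′) g′) (lam (app (val (shiftV 0 K)) T′)))
             (cong₂ _,_ (substV-closed 0 K g sg) (substV-closed 0 K R sR)) (substV-scoped 1 K T sT ≤-refl)

  select-cons : ∀ (j : Fin n) r g K →
                app (app (appN (val (encStr (j ∷ r))) (suc n) branch) g) K
                  →det[ suc n ] app (app (app (val (onCons (toℕ j))) (encStr r)) g) K
  select-cons j r g K =
    retarget (ctx* (ctx* (select n (n ∸ toℕ j) branch (encStr r ∷ []) (m∸n≤m n (toℕ j)) branch-closed (encStr-closed r ∷ []))))
             (cong (λ v → app (app (app (val v) (encStr r)) g) K) chosen)
    where
      chosen : branch (n ∸ (n ∸ toℕ j)) ≡ onCons (toℕ j)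
      chosen = trans (cong branch (m∸[m∸n]≡n (<⇒≤ (toℕ<n j)))) (branch-< (toℕ j) (toℕ<n j))

  select-nil : ∀ g K → app (app (appN (val (encStr {n} [])) (suc n) branch) g) K
                         →det[ suc n ] app (app (val onNil) g) K
  select-nil g K =
    retarget (ctx* (ctx* (select n 0 branch [] z≤n branch-closed []))) (cong (λ v → app (app (val v) g) K) branch-n)

  consTemplate-[] : ∀ (j : Fin n) (r : List (Fin (suc n))) →
                    substV 0 (encStr r) (consTemplate (toℕ j)) ≡ encStr (inject₁ j ∷ r)
  consTemplate-[] j r = cong lam (trans (substT-lams (suc n) 1 X body) (cong (lams (suc n)) body[X]))
    where
      X = encStr r
      body = app (val (var (suc n ∸ toℕ j))) (var (suc (suc n)))
      body[X] : substT (suc n + 1) X body ≡ app (val (var (suc n ∸ toℕ (inject₁ j)))) X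
      body[X] rewrite +-comm n 1 | toℕ-inject₁ j =
        cong₂ (λ v w → app (val v) w)
          (substVar-< (suc (suc n)) X (suc n ∸ toℕ j) (s≤s (m∸n≤m (suc n) (toℕ j))))
          (substVar-self (suc (suc n)) X (encStr-closed r))

  convertSteps : List (Fin n) → ℕ
  convertSteps []      = 3 + (suc n + 2)
  convertSteps (j ∷ s) = 3 + (suc n + (3 + (convertSteps s + 1)))

  convert-→det : ∀ s K → app (app (app (val convert) (encStr s)) convert) K
                           →det[ convertSteps s ] app (val K) (encStr (map inject₁ s))
  convert-→det [] K =
    convert-unfold _ convert K (encStr-closed {n} []) convert-closed
    ▷ select-nil convert K
    ▷ onNil-unfold convert K convert-closed
  convert-→det (j ∷ s) K =
    convert-unfold _ convert K (encStr-closed (j ∷ s)) convert-closed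
    ▷ select-cons j s convert K
    ▷ onCons-unfold (toℕ j) (encStr s) convert K (encStr-closed s) convert-closed
    ▷ convert-→det s (lam (app (val (shiftV 0 K)) (consTemplate (toℕ j))))
    ▷ one-step (β≡ (cong₂ (λ v w → app (val v) w)
                          (substV-shiftV 0 (encStr (map inject₁ s)) K) (consTemplate-[] j (map inject₁ s))))

  length≤convertSteps : ∀ s → length s ≤ convertSteps s
  length≤convertSteps []      = z≤n
  length≤convertSteps (j ∷ s) = s≤s (≤-trans (length≤convertSteps s)
    (≤-trans (m≤m+n (convertSteps s) 1) (≤-trans (m≤n+m _ 3) (≤-trans (m≤n+m _ (suc n)) (m≤n+m _ 2)))))

  convertSteps+4≤ : ∀ s → convertSteps s + 4 ≤ (n + 10) * suc (length s)
  convertSteps+4≤ []      = ≤-reflexive (nil-identity n)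
    where
      nil-identity : ∀ a → 3 + (suc a + 2) + 4 ≡ (a + 10) * 1
      nil-identity = solve-∀
  convertSteps+4≤ (j ∷ s) = begin
    convertSteps (j ∷ s) + 4          ≡⟨ cons-identity n (convertSteps s) ⟩
    (n + 8) + (convertSteps s + 4)    ≤⟨ +-mono-≤ (+-monoʳ-≤ n (m≤m+n 8 2)) (convertSteps+4≤ s) ⟩
    (n + 10) + (n + 10) * suc (length s) ≡⟨ sym (*-suc (n + 10) (suc (length s))) ⟩
    (n + 10) * suc (length (j ∷ s))   ∎
    where
      open ≤-Reasoning
      cons-identity : ∀ a b → 3 + (suc a + (3 + (b + 1))) + 4 ≡ (a + 8) + (b + 4)
      cons-identity = solve-∀

  box ⌜qin⌝ : Val
  box   = encSym {suc n} (fromℕ n)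
  ⌜qin⌝ = encSym qin

  box-closed : ClosedV box
  box-closed = encSym-closed (fromℕ n)

  ⌜qin⌝-closed : ClosedV ⌜qin⌝
  ⌜qin⌝-closed = encSym-closed qin

  -- λx. x ⌜ε⌝ ⌜□⌝ X ⌜q_in⌝, with the converted tape X free as index 2 below the binder k of finish.
  initialConf : Val
  initialConf = lam (app (app (app (app (val (var 0)) empty) box) (var 2)) ⌜qin⌝)

  finish : Val
  finish = lam (val (lam (app (val (var 0)) initialConf)))

  init : Term
  init = val (lam (val (lam (app (app (app (app (val convert) (var 0)) convert) finish) (var 1)))))

  finish-closed : ClosedV finish
  finish-closed = s≤s z≤n
                , (((s≤s z≤n , ClosedV-weaken 3 empty empty-closed)
                   , ClosedV-weaken 3 box box-closed)
                  , s≤s (s≤s (s≤s z≤n)))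
                , ClosedV-weaken 3 ⌜qin⌝ ⌜qin⌝-closed

  init-closed : Closed init
  init-closed = (((ClosedV-weaken 2 convert convert-closed , s≤s z≤n) , ClosedV-weaken 2 convert convert-closed)
                , ClosedV-weaken 2 finish finish-closed)
              , s≤s (s≤s z≤n)

  encConf-Cin-closed : ∀ s → ClosedV (encConf M (Cin M s))
  encConf-Cin-closed s = (((s≤s z≤n , ClosedV-weaken 1 empty empty-closed)
                          , ClosedV-weaken 1 box box-closed)
                         , ClosedV-weaken 1 (encStr (map inject₁ s)) (encStr-closed (map inject₁ s)))
                       , ClosedV-weaken 1 ⌜qin⌝ ⌜qin⌝-closed

  init-→det : ∀ k s → app (app init k) (encStr s)
                        →det[ 2 + (convertSteps s + 2) ] app (val k) (encConf M (Cin M s))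
  init-→det k s =
    one-step (ctx (β≡ e₁)) ▷ one-step (β≡ e₂) ▷ ctx* (convert-→det s finish)
    ▷ one-step (ctx (β≡ e₃)) ▷ one-step (β≡ e₄)
    where
      S = encStr s
      X = encStr (map inject₁ s)
      C = encConf M (Cin M s)
      e₁ : val (lam (app (app (app (app (val convert) (var 0)) convert) finish) (var 1))) [ k ]
           ≡ val (lam (app (app (app (app (val convert) (var 0)) convert) finish) (shiftV 0 k)))
      e₁ = cong₂ (λ g f → val (lam (app (app (app (app (val g) (var 0)) g) f) (shiftV 0 k))))
             (substV-closed 1 k convert convert-closed) (substV-closed 1 k finish finish-closed)
      e₂ : app (app (app (app (val convert) (var 0)) convert) finish) (shiftV 0 k) [ S ]
           ≡ app (app (app (app (val convert) S) convert) finish) k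
      e₂ = cong₂ (λ (p : Val × Val) k′ → let (g , f) = p in app (app (app (app (val g) S) g) f) k′)
             (cong₂ _,_ (substV-closed 0 S convert convert-closed) (substV-closed 0 S finish finish-closed))
             (substV-shiftV 0 S k)
      e₃ : val (lam (app (val (var 0)) initialConf)) [ X ] ≡ val (lam (app (val (var 0)) C))
      e₃ = cong (λ c → val (lam (app (val (var 0)) (lam c))))
             (cong₂ (λ (p q : Val × Val) → let (e , b) = p ; (x , q′) = q in
                       app (app (app (app (val (var 0)) e) b) x) q′)
               (cong₂ _,_ (substV-closed 2 X empty empty-closed)
                          (substV-closed 2 X box box-closed))
               (cong₂ _,_ (substVar-self 2 X (encStr-closed (map inject₁ s)))
                          (substV-closed 2 X ⌜qin⌝ ⌜qin⌝-closed)))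
      e₄ : app (val (var 0)) C [ k ] ≡ app (val k) C
      e₄ = cong (app (val k)) (substV-closed 0 k C (encConf-Cin-closed s))

lemma5 : (M : TM) →
    ∃[ init ] Closed init × (∃[ c₁ ] ∃[ c₂ ] (∀ (k : Val) (s : List (Σ M)) →
      ∃[ steps ] (app (app init k) (encStr s) →det[ steps ] app (val k) (encConf M (Cin M s)))
        × (length s ≤ c₁ * steps) × (steps ≤ c₂ * suc (length s))))
lemma5 M = init , init-closed , 1 , n + 10 , λ k s →
  2 + (convertSteps s + 2) , init-→det k s , lower s , upper s
  where
    open TM M using (n)
    open Conversion M

    steps≡ : ∀ a → 2 + (a + 2) ≡ a + 4
    steps≡ = solve-∀

    lower : ∀ s → length s ≤ 1 * (2 + (convertSteps s + 2))
    lower s = begin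
      length s                      ≤⟨ length≤convertSteps s ⟩
      convertSteps s                ≤⟨ m≤n+m _ 2 ⟩
      2 + convertSteps s            ≤⟨ +-monoʳ-≤ 2 (m≤m+n _ 2) ⟩
      2 + (convertSteps s + 2)      ≡⟨ sym (*-identityˡ _) ⟩
      1 * (2 + (convertSteps s + 2)) ∎
      where open ≤-Reasoning

    upper : ∀ s → 2 + (convertSteps s + 2) ≤ (n + 10) * suc (length s)
    upper s = ≤-trans (≤-reflexive (steps≡ (convertSteps s))) (convertSteps+4≤ s)
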